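{- Let $n\ge 1$, $q\ge 2$ and $i_0,\dots,i_{q-1}\in Q_q$, and let $C$ be the layer-latin $(n+1)$-cube of order $q$ whose layers are $L[\varepsilon_{i_0},n],L[\varepsilon_{i_1},n],\dots,L[\varepsilon_{i_{q-1}},n]$. (1) If $q$ is odd, then $C$ has a transversal if and only if $\sum_{j=0}^{q-1} i_j=0$ (mod $q$). (2) If $q$ is even, then $C$ has a transversal if and only if $\sum_{j=0}^{q-1} i_j=0$ (mod $q$) when $n$ is odd, and $\sum_{j=0}^{q-1} i_j=q/2$ (mod $q$) when $n$ is even.
   Context: $Q_q=\{0,\dots,q-1\}$, $+$ is addition modulo $q$, and $\varepsilon_i$ is the permutation $x\mapsto x+i$ of $Q_q$. A latin $n$-cube of order $q$ is a map $Q_q^n\to Q_q$ such that every line contains all $q$ symbols. For a permutation $\pi$ of $Q_q$, $L[\pi,n]$ is the latin $n$-cube $(x_1,\dots,x_n)\mapsto \pi(x_1)+x_2+\dots+x_n$. A layer-latin $(n+1)$-cube of order $q$ is an array of size $q\times\cdots\times q$ ($n+1$ dimensions) over $Q_q$ each of whose layers (first coordinate fixed) is a latin $n$-cube; its hyperplanes are the cell sets obtained by fixing any one of its $n+1$ coordinates; a transversal is a set of $q$ cells with at most one cell in each hyperplane and pairwise distinct symbols. -}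

module Defs where

open import Data.Nat using (ℕ; zero; suc; NonZero)
import Data.Nat as ℕ
open import Data.Nat.DivMod using (_mod_)
open import Data.Fin using (Fin; toℕ)
open import Data.Product using (Σ; _×_; _,_; proj₁; proj₂)
open import Function.Definitions using (Injective)
open import Relation.Binary.PropositionalEquality using (_≡_)

_⊕_ : ∀ {q} .{{_ : NonZero q}} → Fin q → Fin q → Fin q
_⊕_ {q} a b = (toℕ a ℕ.+ toℕ b) mod q

ε : ∀ {q} .{{_ : NonZero q}} → Fin q → Fin q → Fin q
ε i x = x ⊕ i

sumFrom : ∀ {q} .{{_ : NonZero q}} → Fin q → ∀ m → (Fin m → Fin q) → Fin q
sumFrom acc zero    x = acc
sumFrom acc (suc m) x = sumFrom (acc ⊕ x Fin.zero) m (λ j → x (Fin.suc j))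
  where import Data.Fin as Fin

-- L[π,n] : (x_1,…,x_n) ↦ π(x_1) + x_2 + … + x_n   (n ≥ 1, indexed by suc m)
L : ∀ {q} .{{_ : NonZero q}} → (Fin q → Fin q) → ∀ m → (Fin (suc m) → Fin q) → Fin q
L π m x = sumFrom (π (x Fin.zero)) m (λ j → x (Fin.suc j))
  where import Data.Fin as Fin

-- a layer-latin (n+1)-cube: first coordinate selects the layer
LayerCube : ℕ → ℕ → Set
LayerCube q n = Fin q → (Fin n → Fin q) → Fin q

Cell : ℕ → ℕ → Set
Cell q n = Fin q × (Fin n → Fin q)

Ccube : ∀ {q} .{{_ : NonZero q}} → (Fin q → Fin q) → ∀ m → LayerCube q (suc m)
Ccube i m x₀ x = L (ε (i x₀)) m x

-- a transversal: q cells t 0, …, t (q-1), at most one in each hyperplane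
-- (coordinate k of the cells is injective, for each of the n+1 coordinates),
-- with pairwise distinct symbols
IsTransversal : ∀ {q n} → LayerCube q n → (Fin q → Cell q n) → Set
IsTransversal {q} {n} C t =
  Injective _≡_ _≡_ (λ j → proj₁ (t j)) ×
  (∀ (k : Fin n) → Injective _≡_ _≡_ (λ j → proj₂ (t j) k)) ×
  Injective _≡_ _≡_ (λ j → C (proj₁ (t j)) (proj₂ (t j)))

HasTransversal : ∀ {q n} → LayerCube q n → Set
HasTransversal {q} {n} C = Σ (Fin q → Cell q n) (IsTransversal C)

sumQ : ∀ {q} .{{_ : NonZero q}} → (Fin q → Fin q) → Fin q
sumQ {q} i = sumFrom (0 mod q) q i

-- Summing the symbols of a transversal, each coordinate and the symbols run over all of Q_q, so
-- Σ_j i_j + (n-1)·S = 0 where S = Σ_{x ∈ Q_q} x. Conversely, if this holds then d_j = i_j + (n-1)·j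
-- has zero sum, so by Hall's theorem (a zero-sum sequence in a finite abelian group is a difference
-- β − α of two permutations) the cells (j, α_j, j, …, j) form a transversal. Finally S = 0 for odd q,
-- while for even q, S = q/2 and (n-1)·(q/2) is 0 or q/2 according to the parity of n.

module Submission where

open import Defs
open import Level using (0ℓ)
open import Algebra.Bundles using (AbelianGroup; Group)
open import Algebra.Core using (Op₁; Op₂)
open import Algebra.Structures using (IsAbelianGroup)
open import Algebra.Consequences.Propositional using (comm∧idˡ⇒id; comm∧invˡ⇒inv)
import Algebra.Definitions.RawMonoid as RawMonoidDefinitions
import Algebra.Properties.AbelianGroup as AbelianGroupProperties
import Algebra.Properties.CommutativeMonoid.Sum as CommutativeMonoidSum
import Algebra.Properties.CommutativeSemigroup as CommutativeSemigroupProperties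
open import Data.Nat using (ℕ; zero; suc; pred; NonZero; _%_; _/_; _<_; _≤_; z≤n; s≤s)
open import Data.Nat.DivMod
  using (_mod_; %-distribˡ-+; m<n⇒m%n≡m; n%n≡0; m*n%n≡0; m%n<n; m≡m%n+[m/n]*n)
open import Data.Nat.Properties
  using (+-comm; +-assoc; m∸n+n≡m; *-cancelʳ-≡; +-cancelʳ-≡; +-0-commutativeMonoid;
         n<1+n; <⇒≤; m≤n⇒m<n∨m≡n; ≤-refl; m<n⇒m<1+n; <-irrefl; suc-injective)
open import Data.Nat.Tactic.RingSolver using (solve-∀)
open import Data.Fin using (Fin; zero; suc; toℕ; fromℕ<; punchIn; punchOut)
open import Data.Fin.Properties
  using (_≟_; any?; toℕ-injective; toℕ-fromℕ<; toℕ<n; toℕ-inject₁; toℕ-fromℕ;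
         pigeonhole; punchInᵢ≢i; punchOut-injective; injective⇒≤)
open import Data.Fin.Permutation using (Permutation′; permutation)
open import Data.List using (List; []; _∷_; filter; allFin)
open import Data.List.Relation.Unary.All as All using (All; []; _∷_)
open import Data.List.Relation.Unary.All.Properties using (all-filter)
open import Data.List.Membership.Propositional.Properties using (∈-filter⁺; ∈-allFin)
open import Data.Product using (∃; _×_; _,_; proj₁; proj₂)
open import Data.Sum using (_⊎_; inj₁; inj₂)
open import Function using (id; _∘_; const)
open import Function.Bundles using (_⇔_; mk⇔; Equivalence)
open import Function.Definitions using (Injective)
open import Relation.Binary.Definitions using (DecidableEquality)
open import Relation.Binary.PropositionalEquality
  using (_≡_; _≢_; _≗_; refl; sym; trans; cong; cong₂; isEquivalence; module ≡-Reasoning)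
open import Relation.Nullary using (yes; no; ¬_; ¬?; contradiction)
open import Relation.Nullary.Decidable using (_⊎-dec_)
open import Relation.Unary using (Decidable)

open ≡-Reasoning

injective⇒surjective : ∀ {n} {f : Fin n → Fin n} → Injective _≡_ _≡_ f → ∀ y → ∃ λ x → f x ≡ y
injective⇒surjective {suc n} {f} f-inj y with any? (λ x → f x ≟ y)
... | yes found = found
... | no ∄x = contradiction (injective⇒≤ g-injective) (<-irrefl refl)
  where
  g : Fin (suc n) → Fin n
  g x = punchOut (λ fx≡y → ∄x (x , sym fx≡y))
  g-injective : Injective _≡_ _≡_ g
  g-injective eq = f-inj (punchOut-injective {i = y} _ _ eq)

least-witness : ∀ {P : ℕ → Set} → Decidable P → ∀ {n} → P n →
                ∃ λ t → P t × (∀ u → u < t → ¬ P u)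
least-witness         P? {zero}  P0 = zero , P0 , λ _ ()
least-witness {P = P} P? {suc n} Pn with P? zero
... | yes P0 = zero , P0 , λ _ ()
... | no ¬P0 with least-witness (λ u → P? (suc u)) Pn
... | t , Pt , below = suc t , Pt , earlier
  where
  earlier : ∀ u → u < suc t → ¬ P u
  earlier zero    _         = ¬P0
  earlier (suc u) (s≤s u<t) = below u u<t

suc%-view : ∀ {k M} .{{_ : NonZero M}} → k < M →
            (suc k < M × suc k % M ≡ suc k) ⊎ (suc k ≡ M × suc k % M ≡ 0)
suc%-view k<M with m≤n⇒m<n∨m≡n k<M
... | inj₁ 1+k<M = inj₁ (1+k<M , m<n⇒m%n≡m 1+k<M)
... | inj₂ refl  = inj₂ (refl , n%n≡0 _)

suc%-injective : ∀ {a b M} .{{_ : NonZero M}} → a < M → b < M → suc a % M ≡ suc b % M → a ≡ b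
suc%-injective a<M b<M eq with suc%-view a<M | suc%-view b<M
... | inj₁ (_ , ea) | inj₁ (_ , eb) = cong pred (trans (sym ea) (trans eq eb))
... | inj₁ (_ , ea) | inj₂ (_ , eb) with () ← trans (sym ea) (trans eq eb)
... | inj₂ (_ , ea) | inj₁ (_ , eb) with () ← trans (sym eb) (trans (sym eq) ea)
... | inj₂ (ea , _) | inj₂ (eb , _) = cong pred (trans ea (sym eb))

module Rotation {A : Set} (_≟_ : DecidableEquality A) (f : ℕ → A) (M : ℕ) .{{_ : NonZero M}}
                (f-injective : ∀ {a b} → a < M → b < M → f a ≡ f b → a ≡ b) where

  rotate : A → A
  rotate x with any? (λ (k : Fin M) → f (toℕ k) ≟ x)
  ... | yes (k , _) = f (suc (toℕ k) % M)
  ... | no  _       = x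

  rotate-on : ∀ {k} → k < M → rotate (f k) ≡ f (suc k % M)
  rotate-on {k} k<M with any? (λ (k′ : Fin M) → f (toℕ k′) ≟ f k)
  ... | yes (k′ , eq) = cong (λ i → f (suc i % M)) (f-injective (toℕ<n k′) k<M eq)
  ... | no ∄k = contradiction (fromℕ< k<M , cong f (toℕ-fromℕ< k<M)) ∄k

  rotate-off : ∀ {x} → (∀ k → k < M → f k ≢ x) → rotate x ≡ x
  rotate-off {x} off with any? (λ (k : Fin M) → f (toℕ k) ≟ x)
  ... | yes (k , eq) = contradiction eq (off (toℕ k) (toℕ<n k))
  ... | no _ = refl

  rotate-injective : Injective _≡_ _≡_ rotate
  rotate-injective {x} {y} eq with any? (λ (k : Fin M) → f (toℕ k) ≟ x)
                                 | any? (λ (k : Fin M) → f (toℕ k) ≟ y)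
  ... | yes (a , refl) | yes (b , refl) =
    cong f (suc%-injective (toℕ<n a) (toℕ<n b) (f-injective (m%n<n _ M) (m%n<n _ M) eq))
  ... | yes (a , _) | no ∄b = contradiction (fromℕ< (m%n<n _ M) , trans (cong f (toℕ-fromℕ< _)) eq) ∄b
  ... | no ∄a | yes (b , _) = contradiction (fromℕ< (m%n<n _ M) , trans (cong f (toℕ-fromℕ< _)) (sym eq)) ∄a
  ... | no _ | no _ = eq

-- Hall's theorem for abelian groups on Fin N

module Hall {N : ℕ} {_∙_ : Op₂ (Fin N)} {ε : Fin N} {_⁻¹ : Op₁ (Fin N)}
            (isAbelianGroup : IsAbelianGroup _≡_ _∙_ ε _⁻¹) where

  abelianGroup : AbelianGroup 0ℓ 0ℓ
  abelianGroup = record { isAbelianGroup = isAbelianGroup }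

  open AbelianGroup abelianGroup public using (identityʳ)
  open AbelianGroup abelianGroup
    using (assoc; identityˡ; group; rawMonoid; commutativeMonoid; commutativeSemigroup)
    renaming (_∙_ to infixl 6 _+_; ε to 0#)
  open Group group using (_\\_; _-_)
  open AbelianGroupProperties abelianGroup public using (identityʳ-unique)
  open AbelianGroupProperties abelianGroup
    using (∙-cancelˡ; ∙-cancelʳ; inverseˡ-unique; //-rightDividesˡ; \\-leftDividesˡ; \\-leftDividesʳ)
  open CommutativeMonoidSum commutativeMonoid public
    using (sum; sum-cong-≗; ∑-distrib-+; ∑-comm; sum-replicate)
  open CommutativeMonoidSum commutativeMonoid using (∑-permute; sum-remove; sum-replicate-zero)
  open RawMonoidDefinitions rawMonoid public using () renaming (_×_ to _·_)
  open CommutativeSemigroupProperties commutativeSemigroup using (xy∙z≈zy∙x)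

  sumAll : Fin N
  sumAll = sum id

  sum-∘-injective : ∀ {f : Fin N → Fin N} → Injective _≡_ _≡_ f →
                    ∀ (g : Fin N → Fin N) → sum (g ∘ f) ≡ sum g
  sum-∘-injective {f} f-injective g = sym (∑-permute g π)
    where
    f⁻¹ : Fin N → Fin N
    f⁻¹ y = proj₁ (injective⇒surjective f-injective y)
    π : Permutation′ N
    π = permutation f f⁻¹ (λ y → proj₂ (injective⇒surjective f-injective y))
                          (λ x → f-injective (proj₂ (injective⇒surjective f-injective (f x))))

  equal-sums⇒agree-at : ∀ {n} (f g : Fin n → Fin N) i → (∀ j → j ≢ i → f j ≡ g j) →
                       sum f ≡ sum g → f i ≡ g i
  equal-sums⇒agree-at {suc n} f g i agree Σf≡Σg = ∙-cancelʳ (sum (g ∘ punchIn i)) (f i) (g i) (begin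
    f i + sum (g ∘ punchIn i) ≡⟨ cong (f i +_) (sum-cong-≗ λ k → agree _ (punchInᵢ≢i i k)) ⟨
    f i + sum (f ∘ punchIn i) ≡⟨ sum-remove f ⟨
    sum f                     ≡⟨ Σf≡Σg ⟩
    sum g                     ≡⟨ sum-remove g ⟩
    g i + sum (g ∘ punchIn i) ∎)

  sum-injective : ∀ {f : Fin N → Fin N} → Injective _≡_ _≡_ f → sum f ≡ sumAll
  sum-injective f-injective = sum-∘-injective f-injective id

  sum-· : ∀ {n} m (f : Fin n → Fin N) → sum (λ j → m · f j) ≡ m · sum f
  sum-· {n} m f = begin
    sum (λ j → m · f j)                   ≡⟨ sum-cong-≗ (λ j → sum-replicate m {f j}) ⟨
    sum (λ j → sum {m} (λ _ → f j))       ≡⟨ ∑-comm {n} {m} (λ j _ → f j) ⟩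
    sum {m} (λ _ → sum f)                 ≡⟨ sum-replicate m ⟩
    m · sum f                             ∎

  ·-zero : ∀ m → m · 0# ≡ 0#
  ·-zero m = trans (sym (sum-replicate m)) (sum-replicate-zero m)

  ·-order-two : ∀ {x} → x + x ≡ 0# → ∀ m →
                (suc m % 2 ≡ 1 → m · x ≡ 0#) × (suc m % 2 ≡ 0 → m · x ≡ x)
  ·-order-two x+x≡0 zero          = (λ _ → refl) , (λ ())
  ·-order-two x+x≡0 (suc zero)    = (λ ()) , (λ _ → identityʳ _)
  ·-order-two {x} x+x≡0 (suc (suc m)) =
    (λ odd → trans drop-pair (proj₁ (·-order-two x+x≡0 m) odd)) ,
    (λ even → trans drop-pair (proj₂ (·-order-two x+x≡0 m) even))
    where
    drop-pair : suc (suc m) · x ≡ m · x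
    drop-pair = begin
      x + (x + m · x) ≡⟨ assoc x x (m · x) ⟨
      (x + x) + m · x ≡⟨ cong (_+ m · x) x+x≡0 ⟩
      0# + m · x      ≡⟨ identityˡ (m · x) ⟩
      m · x           ∎

  +-order-two⇒[+≡0⇔≡] : ∀ {c} → c + c ≡ 0# → ∀ x → (x + c ≡ 0# ⇔ x ≡ c)
  +-order-two⇒[+≡0⇔≡] {c} c+c≡0 x = mk⇔
    (λ x+c≡0 → trans (inverseˡ-unique x c x+c≡0) (sym (inverseˡ-unique c c c+c≡0)))
    (λ { refl → c+c≡0 })

  record PermutationDifference (d : Fin N → Fin N) : Set where
    field
      α β         : Fin N → Fin N
      α-injective : Injective _≡_ _≡_ α
      β-injective : Injective _≡_ _≡_ β
      β≡α+d       : ∀ j → β j ≡ α j + d j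

  zero-difference : PermutationDifference (const 0#)
  zero-difference = record
    { α = id ; β = id ; α-injective = id ; β-injective = id ; β≡α+d = λ j → sym (identityʳ j) }

  difference-cong : ∀ {d d′} → d ≗ d′ → PermutationDifference d → PermutationDifference d′
  difference-cong d≗d′ D = record
    { α = α ; β = β ; α-injective = α-injective ; β-injective = β-injective
    ; β≡α+d = λ j → trans (β≡α+d j) (cong (α j +_) (d≗d′ j)) }
    where open PermutationDifference D

  difference-sum≡0 : ∀ {d} → PermutationDifference d → sum d ≡ 0#
  difference-sum≡0 {d} D = identityʳ-unique sumAll (sum d) (begin
    sumAll + sum d         ≡⟨ cong (_+ sum d) (sum-∘-injective α-injective id) ⟨
    sum α + sum d          ≡⟨ ∑-distrib-+ α d ⟨
    sum (λ j → α j + d j)  ≡⟨ sum-cong-≗ (sym ∘ β≡α+d) ⟩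
    sum β                  ≡⟨ sum-∘-injective β-injective id ⟩
    sumAll                 ∎)
    where open PermutationDifference D

  x≡y+d⇒y\\x≡d : ∀ {x y d} → x ≡ y + d → y \\ x ≡ d
  x≡y+d⇒y\\x≡d {y = y} {d} refl = \\-leftDividesʳ y d

  -- Follow the chain r₀ = ℓ, r_{k+1} = σ r_k, where β (σ x) + α x = K and K is
  -- chosen so that β r₁ = α p + e, up to its first return s to {p, ℓ}. Composing α with
  -- ρ = (r₀ r₁ … r_{s-1})⁻¹ and β with τ = (p r₁ … r_{s-1} [ℓ]) puts e at p and keeps d off {p, ℓ},
  -- because β r_{k+1} − α r_{k-1} = d r_k along the chain.
  module Exchange {d} (D : PermutationDifference d) {p ℓ : Fin N} (p≢ℓ : p ≢ ℓ) (e : Fin N) where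
    open PermutationDifference D

    K : Fin N
    K = (α p + e) + α ℓ

    σ : Fin N → Fin N
    σ x = proj₁ (injective⇒surjective β-injective (K - α x))

    β∘σ+α≡K : ∀ x → β (σ x) + α x ≡ K
    β∘σ+α≡K x = trans (cong (_+ α x) (proj₂ (injective⇒surjective β-injective _)))
                      (//-rightDividesˡ (α x) K)

    σ-injective : Injective _≡_ _≡_ σ
    σ-injective {x} {y} σx≡σy = α-injective (∙-cancelˡ (β (σ x)) (α x) (α y) (begin
      β (σ x) + α x ≡⟨ β∘σ+α≡K x ⟩
      K             ≡⟨ β∘σ+α≡K y ⟨
      β (σ y) + α y ≡⟨ cong (λ z → β z + α y) σx≡σy ⟨
      β (σ x) + α y ∎))

    r : ℕ → Fin N
    r zero    = ℓ
    r (suc k) = σ (r k)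

    Stop : ℕ → Set
    Stop u = r (suc u) ≡ p ⊎ r (suc u) ≡ ℓ

    returns-to-ℓ : ∀ {a b} → a < b → r a ≡ r b → ∃ λ u → Stop u
    returns-to-ℓ {zero}  {suc u} _          r0≡ru = u , inj₂ (sym r0≡ru)
    returns-to-ℓ {suc a} {suc b} (s≤s a<b) eq    = returns-to-ℓ a<b (σ-injective eq)

    opaque
      first-stop : ∃ λ t → Stop t × ∀ u → u < t → ¬ Stop u
      first-stop with a , b , a<b , ra≡rb ← pigeonhole (n<1+n N) (r ∘ toℕ)
                 with u , stop-u ← returns-to-ℓ a<b ra≡rb
        = least-witness {P = Stop} (λ u → (r (suc u) ≟ p) ⊎-dec (r (suc u) ≟ ℓ)) {u} stop-u

    t s : ℕ
    t = proj₁ first-stop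
    s = suc t

    stop : r s ≡ p ⊎ r s ≡ ℓ
    stop = proj₁ (proj₂ first-stop)

    avoids : ∀ {u} → suc u < s → r (suc u) ≢ p × r (suc u) ≢ ℓ
    avoids (s≤s u<t) = (λ eq → proj₂ (proj₂ first-stop) _ u<t (inj₁ eq))
                     , (λ eq → proj₂ (proj₂ first-stop) _ u<t (inj₂ eq))

    r-injective : ∀ {a b} → a < s → b < s → r a ≡ r b → a ≡ b
    r-injective {zero}  {zero}  _   _   _  = refl
    r-injective {zero}  {suc b} _   b<s eq = contradiction (sym eq) (proj₂ (avoids b<s))
    r-injective {suc a} {zero}  a<s _   eq = contradiction eq (proj₂ (avoids a<s))
    r-injective {suc a} {suc b} a<s b<s eq = cong suc (r-injective (<⇒≤ a<s) (<⇒≤ b<s) (σ-injective eq))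

    r≢p : ∀ {k} → k < s → r k ≢ p
    r≢p {zero}  _   = p≢ℓ ∘ sym
    r≢p {suc k} k<s = proj₁ (avoids k<s)

    module R = Rotation _≟_ r s r-injective

    ρ : Fin N → Fin N
    ρ y = proj₁ (injective⇒surjective R.rotate-injective y)

    ρ-undoes-rotate : ∀ {x y} → R.rotate x ≡ y → ρ y ≡ x
    ρ-undoes-rotate {x} {y} refl = R.rotate-injective (proj₂ (injective⇒surjective R.rotate-injective y))

    ρ-injective : Injective _≡_ _≡_ ρ
    ρ-injective {x} {y} ρx≡ρy = begin
      x              ≡⟨ proj₂ (injective⇒surjective R.rotate-injective x) ⟨
      R.rotate (ρ x) ≡⟨ cong R.rotate ρx≡ρy ⟩
      R.rotate (ρ y) ≡⟨ proj₂ (injective⇒surjective R.rotate-injective y) ⟩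
      y              ∎

    ρ-chain : ∀ {k} → suc k < s → ρ (r (suc k)) ≡ r k
    ρ-chain {k} 1+k<s = ρ-undoes-rotate (trans (R.rotate-on (<⇒≤ 1+k<s)) (cong r (m<n⇒m%n≡m 1+k<s)))

    ρ-off-chain : ∀ {x} → (∀ k → k < s → r k ≢ x) → ρ x ≡ x
    ρ-off-chain off = ρ-undoes-rotate (R.rotate-off off)

    τ-chain : ℕ → Fin N
    τ-chain zero    = p
    τ-chain (suc k) = r (suc k)

    -- τ cycles τ-chain 0, …, τ-chain (τ-last st), i.e. p, r₁, …, r_{s-1}, and also r_s = ℓ if the chain returned to ℓ.
    τ-last : r s ≡ p ⊎ r s ≡ ℓ → ℕ
    τ-last (inj₁ _) = t
    τ-last (inj₂ _) = s

    τ-index : ∀ st {k} → suc k < suc (τ-last st) → suc k < s ⊎ (suc k ≡ s × r s ≡ ℓ)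
    τ-index (inj₁ _)    1+k<s       = inj₁ 1+k<s
    τ-index (inj₂ rs≡ℓ) (s≤s 1+k≤s) with m≤n⇒m<n∨m≡n 1+k≤s
    ... | inj₁ 1+k<s = inj₁ 1+k<s
    ... | inj₂ 1+k≡s = inj₂ (1+k≡s , rs≡ℓ)

    τ-chain-suc≢p : ∀ st {k} → suc k < suc (τ-last st) → r (suc k) ≢ p
    τ-chain-suc≢p st lt with τ-index st lt
    ... | inj₁ 1+k<s          = proj₁ (avoids 1+k<s)
    ... | inj₂ (refl , rs≡ℓ) = λ rs≡p → p≢ℓ (trans (sym rs≡p) rs≡ℓ)

    τ-chain-injective : ∀ st {a b} → a < suc (τ-last st) → b < suc (τ-last st) →
                        τ-chain a ≡ τ-chain b → a ≡ b
    τ-chain-injective st {zero}  {zero}  _  _  _  = refl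
    τ-chain-injective st {zero}  {suc b} _  b< eq = contradiction (sym eq) (τ-chain-suc≢p st b<)
    τ-chain-injective st {suc a} {zero}  a< _  eq = contradiction eq (τ-chain-suc≢p st a<)
    τ-chain-injective st {suc a} {suc b} a< b< eq =
      cong suc (r-injective (below (τ-index st a<)) (below (τ-index st b<)) (σ-injective eq))
      where
      below : ∀ {k} → suc k < s ⊎ (suc k ≡ s × r s ≡ ℓ) → k < s
      below (inj₁ 1+k<s)     = <⇒≤ 1+k<s
      below (inj₂ (refl , _)) = ≤-refl

    module T (st : r s ≡ p ⊎ r s ≡ ℓ) = Rotation _≟_ τ-chain (suc (τ-last st)) (τ-chain-injective st)

    τ : Fin N → Fin N
    τ = T.rotate stop

    τ-chain-step : ∀ st {k} → k < s → T.rotate st (τ-chain k) ≡ r (suc k)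
    τ-chain-step st@(inj₁ rs≡p) {k} k<s with suc%-view k<s
    ... | inj₁ (_ , eq)      = trans (T.rotate-on st k<s) (cong τ-chain eq)
    ... | inj₂ (1+k≡s , eq) =
      trans (T.rotate-on st k<s) (trans (cong τ-chain eq) (sym (trans (cong r 1+k≡s) rs≡p)))
    τ-chain-step st@(inj₂ _) {k} k<s with suc%-view (m<n⇒m<1+n k<s)
    ... | inj₁ (_ , eq)       = trans (T.rotate-on st (m<n⇒m<1+n k<s)) (cong τ-chain eq)
    ... | inj₂ (1+k≡1+s , _) = contradiction k<s (<-irrefl (suc-injective 1+k≡1+s))

    τ-off-chain : ∀ {x} → x ≢ p → x ≢ ℓ → (∀ k → k < s → r k ≢ x) → τ x ≡ x
    τ-off-chain {x} x≢p x≢ℓ off = T.rotate-off stop off-τ-chain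
      where
      off-τ-chain : ∀ k → k < suc (τ-last stop) → τ-chain k ≢ x
      off-τ-chain zero    _  = x≢p ∘ sym
      off-τ-chain (suc k) lt with τ-index stop lt
      ... | inj₁ 1+k<s         = off (suc k) 1+k<s
      ... | inj₂ (refl , rs≡ℓ) = λ rs≡x → x≢ℓ (trans (sym rs≡x) rs≡ℓ)

    d′ : Fin N → Fin N
    d′ j = α (ρ j) \\ β (τ j)

    difference : PermutationDifference d′
    difference = record
      { α = α ∘ ρ ; β = β ∘ τ
      ; α-injective = ρ-injective ∘ α-injective
      ; β-injective = T.rotate-injective stop ∘ β-injective
      ; β≡α+d = λ j → sym (\\-leftDividesˡ (α (ρ j)) (β (τ j))) }

    d′-at-p : d′ p ≡ e
    d′-at-p = x≡y+d⇒y\\x≡d (begin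
      β (τ p)         ≡⟨ cong β (τ-chain-step stop (s≤s z≤n)) ⟩
      β (r 1)         ≡⟨ ∙-cancelʳ (α ℓ) _ _ (β∘σ+α≡K ℓ) ⟩
      α p + e         ≡⟨ cong (λ x → α x + e) (ρ-off-chain (λ _ → r≢p)) ⟨
      α (ρ p) + e     ∎)

    d′-on-chain : ∀ {k} → suc k < s → d′ (r (suc k)) ≡ d (r (suc k))
    d′-on-chain {k} 1+k<s = x≡y+d⇒y\\x≡d (begin
      β (τ (r (suc k)))                  ≡⟨ cong β (τ-chain-step stop 1+k<s) ⟩
      β (r (suc (suc k)))                ≡⟨ ∙-cancelʳ (α (r (suc k))) _ _ link ⟩
      α (r k) + d (r (suc k))            ≡⟨ cong (λ x → α x + d (r (suc k))) (ρ-chain 1+k<s) ⟨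
      α (ρ (r (suc k))) + d (r (suc k))  ∎)
      where
      link : β (r (suc (suc k))) + α (r (suc k)) ≡ (α (r k) + d (r (suc k))) + α (r (suc k))
      link = begin
        β (r (suc (suc k))) + α (r (suc k))        ≡⟨ β∘σ+α≡K (r (suc k)) ⟩
        K                                          ≡⟨ β∘σ+α≡K (r k) ⟨
        β (r (suc k)) + α (r k)                    ≡⟨ cong (_+ α (r k)) (β≡α+d (r (suc k))) ⟩
        (α (r (suc k)) + d (r (suc k))) + α (r k)  ≡⟨ xy∙z≈zy∙x _ _ _ ⟩
        (α (r k) + d (r (suc k))) + α (r (suc k))  ∎

    d′-off-chain : ∀ {j} → j ≢ p → j ≢ ℓ → (∀ k → k < s → r k ≢ j) → d′ j ≡ d j
    d′-off-chain {j} j≢p j≢ℓ off = x≡y+d⇒y\\x≡d (begin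
      β (τ j)        ≡⟨ cong β (τ-off-chain j≢p j≢ℓ off) ⟩
      β j            ≡⟨ β≡α+d j ⟩
      α j + d j      ≡⟨ cong (λ x → α x + d j) (ρ-off-chain off) ⟨
      α (ρ j) + d j  ∎)

    d′-elsewhere : ∀ j → j ≢ p → j ≢ ℓ → d′ j ≡ d j
    d′-elsewhere j j≢p j≢ℓ with any? (λ (k : Fin s) → r (toℕ k) ≟ j)
    ... | yes (k , rk≡j) = on-chain (toℕ k) (toℕ<n k) rk≡j
      where
      on-chain : ∀ k → k < s → r k ≡ j → d′ j ≡ d j
      on-chain zero    _     refl = contradiction refl j≢ℓ
      on-chain (suc k) 1+k<s refl = d′-on-chain 1+k<s
    ... | no ∄k = d′-off-chain j≢p j≢ℓ λ k k<s rk≡j → ∄k (fromℕ< k<s , trans (cong r (toℕ-fromℕ< k<s)) rk≡j)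

  exchange : ∀ {d} → PermutationDifference d → ∀ {p ℓ} → p ≢ ℓ → ∀ e →
             ∃ λ d′ → PermutationDifference d′ × d′ p ≡ e × (∀ j → j ≢ p → j ≢ ℓ → d′ j ≡ d j)
  exchange D p≢ℓ e = d′ , difference , d′-at-p , d′-elsewhere
    where open Exchange D p≢ℓ e

  prescribe : ∀ (d : Fin N → Fin N) ℓ (ps : List (Fin N)) → All (_≢ ℓ) ps →
              ∃ λ d′ → PermutationDifference d′ × All (λ j → d′ j ≡ d j) ps
  prescribe d ℓ []       []             = const 0# , zero-difference , []
  prescribe d ℓ (p ∷ ps) (p≢ℓ ∷ ps≢ℓ) with prescribe d ℓ ps ps≢ℓ
  ... | d′ , D′ , agree with exchange D′ p≢ℓ (d p)
  ... | d″ , D″ , at-p , elsewhere = d″ , D″ , at-p ∷ All.zipWith kept (ps≢ℓ , agree)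
    where
    kept : ∀ {j} → j ≢ ℓ × d′ j ≡ d j → d″ j ≡ d j
    kept {j} (j≢ℓ , d′j≡dj) with j ≟ p
    ... | yes refl = at-p
    ... | no j≢p   = trans (elsewhere j j≢p j≢ℓ) d′j≡dj

  private
    ≢0? : Decidable (_≢ 0#)
    ≢0? j = ¬? (j ≟ 0#)

  -- Every position but 0# is set by an exchange compensating at 0#; the value at 0# is then forced by the sum.
  hall : ∀ (d : Fin N → Fin N) → sum d ≡ 0# → PermutationDifference d
  hall d Σd≡0 with prescribe d 0# (filter ≢0? (allFin N)) (all-filter ≢0? (allFin N))
  ... | d′ , D′ , agree = difference-cong d′≗d D′
    where
    agree-off-0 : ∀ j → j ≢ 0# → d′ j ≡ d j
    agree-off-0 j j≢0 = All.lookup agree (∈-filter⁺ ≢0? (∈-allFin j) j≢0)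
    d′≗d : d′ ≗ d
    d′≗d j with j ≟ 0#
    ... | yes refl = equal-sums⇒agree-at d′ d 0# agree-off-0 (trans (difference-sum≡0 D′) (sym Σd≡0))
    ... | no j≢0   = agree-off-0 j j≢0

-- The cyclic group Q_q and the sum of its elements

open import Data.Nat using (_+_; _*_; _∸_)
open CommutativeMonoidSum +-0-commutativeMonoid using ()
  renaming (sum to sumℕ; sum-init-last to sumℕ-init-last; sum-cong-≗ to sumℕ-cong-≗)

gauss : ∀ n → sumℕ {n} toℕ * 2 + n ≡ n * n
gauss zero    = refl
gauss (suc n) = begin
  sumℕ {suc n} toℕ * 2 + suc n           ≡⟨ cong (λ x → x * 2 + suc n) Σ-last ⟩
  (Σ + n) * 2 + suc n                     ≡⟨ expand Σ n ⟩
  (Σ * 2 + n) + (n * 2 + 1)               ≡⟨ cong (_+ (n * 2 + 1)) (gauss n) ⟩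
  n * n + (n * 2 + 1)                     ≡⟨ square n ⟩
  suc n * suc n                           ∎
  where
  Σ : ℕ
  Σ = sumℕ {n} toℕ
  expand : ∀ Σ n → (Σ + n) * 2 + suc n ≡ (Σ * 2 + n) + (n * 2 + 1)
  expand = solve-∀
  square : ∀ n → n * n + (n * 2 + 1) ≡ suc n * suc n
  square = solve-∀
  Σ-last : sumℕ {suc n} toℕ ≡ Σ + n
  Σ-last = trans (sumℕ-init-last {n} toℕ)
                 (cong₂ _+_ (sumℕ-cong-≗ {n} toℕ-inject₁) (toℕ-fromℕ n))

module Cyclic (q′ : ℕ) where

  q : ℕ
  q = suc q′

  ⊖_ : Fin q → Fin q
  ⊖ a = (q ∸ toℕ a) mod q

  toℕ-mod : ∀ n → toℕ (n mod q) ≡ n % q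
  toℕ-mod n = toℕ-fromℕ< _

  mod-toℕ : ∀ (a : Fin q) → a ≡ toℕ a mod q
  mod-toℕ a = toℕ-injective (sym (trans (toℕ-mod (toℕ a)) (m<n⇒m%n≡m (toℕ<n a))))

  mod-+ : ∀ m n → (m + n) mod q ≡ (m mod q) ⊕ (n mod q)
  mod-+ m n = toℕ-injective (begin
    toℕ ((m + n) mod q)                  ≡⟨ toℕ-mod (m + n) ⟩
    (m + n) % q                          ≡⟨ %-distribˡ-+ m n q ⟩
    (m % q + n % q) % q                  ≡⟨ cong₂ (λ x y → (x + y) % q) (toℕ-mod m) (toℕ-mod n) ⟨
    (toℕ (m mod q) + toℕ (n mod q)) % q  ≡⟨ toℕ-mod (toℕ (m mod q) + toℕ (n mod q)) ⟨
    toℕ ((m mod q) ⊕ (n mod q))          ∎)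

  *-mod : ∀ n → (n * q) mod q ≡ zero
  *-mod n = toℕ-injective (trans (toℕ-mod (n * q)) (m*n%n≡0 n q))

  mod-self : q mod q ≡ zero
  mod-self = toℕ-injective (trans (toℕ-mod q) (n%n≡0 q))

  ⊕-comm : ∀ (a b : Fin q) → a ⊕ b ≡ b ⊕ a
  ⊕-comm a b = cong (_mod q) (+-comm (toℕ a) (toℕ b))

  ⊕-assoc : ∀ (a b c : Fin q) → (a ⊕ b) ⊕ c ≡ a ⊕ (b ⊕ c)
  ⊕-assoc a b c = begin
    (a ⊕ b) ⊕ c                          ≡⟨ cong ((a ⊕ b) ⊕_) (mod-toℕ c) ⟩
    (a ⊕ b) ⊕ (toℕ c mod q)              ≡⟨ mod-+ (toℕ a + toℕ b) (toℕ c) ⟨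
    (toℕ a + toℕ b + toℕ c) mod q        ≡⟨ cong (_mod q) (+-assoc (toℕ a) (toℕ b) (toℕ c)) ⟩
    (toℕ a + (toℕ b + toℕ c)) mod q      ≡⟨ mod-+ (toℕ a) (toℕ b + toℕ c) ⟩
    (toℕ a mod q) ⊕ (b ⊕ c)              ≡⟨ cong (_⊕ (b ⊕ c)) (mod-toℕ a) ⟨
    a ⊕ (b ⊕ c)                          ∎

  ⊕-identityˡ : ∀ (a : Fin q) → zero ⊕ a ≡ a
  ⊕-identityˡ a = sym (mod-toℕ a)

  ⊕-inverseˡ : ∀ (a : Fin q) → (⊖ a) ⊕ a ≡ zero
  ⊕-inverseˡ a = begin
    (⊖ a) ⊕ a                        ≡⟨ cong ((⊖ a) ⊕_) (mod-toℕ a) ⟩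
    (⊖ a) ⊕ (toℕ a mod q)            ≡⟨ mod-+ (q ∸ toℕ a) (toℕ a) ⟨
    (q ∸ toℕ a + toℕ a) mod q        ≡⟨ cong (_mod q) (m∸n+n≡m (<⇒≤ (toℕ<n a))) ⟩
    q mod q                          ≡⟨ mod-self ⟩
    zero                             ∎

  isAbelianGroup : IsAbelianGroup _≡_ _⊕_ zero ⊖_
  isAbelianGroup = record
    { isGroup = record
      { isMonoid = record
        { isSemigroup = record
          { isMagma = record { isEquivalence = isEquivalence ; ∙-cong = cong₂ _⊕_ }
          ; assoc = ⊕-assoc }
        ; identity = comm∧idˡ⇒id ⊕-comm ⊕-identityˡ }
      ; inverse = comm∧invˡ⇒inv ⊕-comm ⊕-inverseˡ
      ; ⁻¹-cong = cong ⊖_ }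
    ; comm = ⊕-comm }

  open Hall isAbelianGroup public using (sumAll; _·_; ·-zero; ·-order-two)
  open Hall isAbelianGroup
    using (sum; sum-cong-≗; ∑-distrib-+; ∑-comm; sum-replicate; sum-∘-injective; sum-injective; sum-·;
           identityʳ; identityʳ-unique; +-order-two⇒[+≡0⇔≡]; PermutationDifference; hall)

  sum≡sumℕ-mod : ∀ {n} (f : Fin n → Fin q) → sum f ≡ sumℕ (toℕ ∘ f) mod q
  sum≡sumℕ-mod {zero}  f = refl
  sum≡sumℕ-mod {suc n} f = begin
    f zero ⊕ sum (f ∘ suc)                                 ≡⟨ cong₂ _⊕_ (mod-toℕ (f zero)) (sum≡sumℕ-mod (f ∘ suc)) ⟩
    (toℕ (f zero) mod q) ⊕ (sumℕ (toℕ ∘ f ∘ suc) mod q)    ≡⟨ mod-+ (toℕ (f zero)) _ ⟨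
    (toℕ (f zero) + sumℕ (toℕ ∘ f ∘ suc)) mod q            ∎

  half : Fin q
  half = (q / 2) mod q

  sumAll-odd : q % 2 ≡ 1 → sumAll ≡ zero
  sumAll-odd odd = begin
    sumAll                 ≡⟨ sum≡sumℕ-mod id ⟩
    sumℕ {q} toℕ mod q     ≡⟨ cong (_mod q) Σ≡h*q ⟩
    (q / 2 * q) mod q      ≡⟨ *-mod (q / 2) ⟩
    zero                   ∎
    where
    h : ℕ
    h = q / 2
    q≡1+h*2 : q ≡ 1 + h * 2
    q≡1+h*2 = trans (m≡m%n+[m/n]*n q 2) (cong (_+ h * 2) odd)
    expand : ∀ q h → q * (1 + h * 2) ≡ h * q * 2 + q
    expand = solve-∀
    Σ≡h*q : sumℕ {q} toℕ ≡ h * q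
    Σ≡h*q = *-cancelʳ-≡ _ _ 2 (+-cancelʳ-≡ q _ _ (begin
      sumℕ {q} toℕ * 2 + q   ≡⟨ gauss q ⟩
      q * q                  ≡⟨ cong (q *_) q≡1+h*2 ⟩
      q * (1 + h * 2)        ≡⟨ expand q h ⟩
      h * q * 2 + q          ∎))

  half-order-two : q % 2 ≡ 0 → half ⊕ half ≡ zero
  half-order-two even = begin
    half ⊕ half            ≡⟨ mod-+ (q / 2) (q / 2) ⟨
    (q / 2 + q / 2) mod q  ≡⟨ cong (_mod q) (trans (double (q / 2)) (sym q≡h*2)) ⟩
    q mod q                ≡⟨ mod-self ⟩
    zero                   ∎
    where
    q≡h*2 : q ≡ q / 2 * 2
    q≡h*2 = trans (m≡m%n+[m/n]*n q 2) (cong (_+ q / 2 * 2) even)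
    double : ∀ h → h + h ≡ h * 2
    double = solve-∀

  sumAll-even : q % 2 ≡ 0 → sumAll ≡ half
  sumAll-even even = Equivalence.to (+-order-two⇒[+≡0⇔≡] (half-order-two even) sumAll) (begin
    sumAll ⊕ half                        ≡⟨ cong (_⊕ half) (sum≡sumℕ-mod id) ⟩
    (sumℕ {q} toℕ mod q) ⊕ (h mod q)     ≡⟨ mod-+ (sumℕ {q} toℕ) h ⟨
    (sumℕ {q} toℕ + h) mod q             ≡⟨ cong (_mod q) Σ+h≡h*q ⟩
    (h * q) mod q                        ≡⟨ *-mod h ⟩
    zero                                 ∎)
    where
    h : ℕ
    h = q / 2
    q≡h*2 : q ≡ h * 2
    q≡h*2 = trans (m≡m%n+[m/n]*n q 2) (cong (_+ h * 2) even)
    expand : ∀ Σ h → (Σ + h) * 2 ≡ Σ * 2 + h * 2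
    expand = solve-∀
    regroup : ∀ q h → q * (h * 2) ≡ h * q * 2
    regroup = solve-∀
    Σ+h≡h*q : sumℕ {q} toℕ + h ≡ h * q
    Σ+h≡h*q = *-cancelʳ-≡ _ _ 2 (begin
      (sumℕ {q} toℕ + h) * 2     ≡⟨ expand (sumℕ {q} toℕ) h ⟩
      sumℕ {q} toℕ * 2 + h * 2   ≡⟨ cong (sumℕ {q} toℕ * 2 +_) q≡h*2 ⟨
      sumℕ {q} toℕ * 2 + q       ≡⟨ gauss q ⟩
      q * q                      ≡⟨ cong (q *_) q≡h*2 ⟩
      q * (h * 2)                ≡⟨ regroup q h ⟩
      h * q * 2                  ∎)

  -- Transversals of C

  sumFrom≡ : ∀ acc m (x : Fin m → Fin q) → sumFrom acc m x ≡ acc ⊕ sum x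
  sumFrom≡ acc zero    x = sym (identityʳ acc)
  sumFrom≡ acc (suc m) x = trans (sumFrom≡ (acc ⊕ x zero) m (x ∘ suc)) (⊕-assoc acc (x zero) _)

  sumQ≡sum : ∀ (i : Fin q → Fin q) → sumQ i ≡ sum i
  sumQ≡sum i = trans (sumFrom≡ zero q i) (⊕-identityˡ (sum i))

  Ccube≡ : ∀ (i : Fin q → Fin q) m x₀ x → Ccube i m x₀ x ≡ (x zero ⊕ i x₀) ⊕ sum (x ∘ suc)
  Ccube≡ i m x₀ x = sumFrom≡ (x zero ⊕ i x₀) m (x ∘ suc)

  transversal⇒ : ∀ (i : Fin q → Fin q) m → HasTransversal (Ccube i m) → sum i ⊕ (m · sumAll) ≡ zero
  transversal⇒ i m (cell , layer-injective , coordinate-injective , symbol-injective) =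
    identityʳ-unique sumAll _ (sym (begin
      sumAll                                                             ≡⟨ sum-injective symbol-injective ⟨
      sum (λ j → Ccube i m (x₀ j) (x j))                                 ≡⟨ sum-cong-≗ (λ j → Ccube≡ i m (x₀ j) (x j)) ⟩
      sum (λ j → (x j zero ⊕ i (x₀ j)) ⊕ sum (x j ∘ suc))                ≡⟨ ∑-distrib-+ (λ j → x j zero ⊕ i (x₀ j)) (λ j → sum (x j ∘ suc)) ⟩
      sum (λ j → x j zero ⊕ i (x₀ j)) ⊕ sum (λ j → sum (x j ∘ suc))      ≡⟨ cong₂ _⊕_ heads tails ⟩
      (sumAll ⊕ sum i) ⊕ (m · sumAll)                                    ≡⟨ ⊕-assoc sumAll (sum i) (m · sumAll) ⟩
      sumAll ⊕ (sum i ⊕ (m · sumAll))                                    ∎))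
    where
    x₀ : Fin q → Fin q
    x₀ j = proj₁ (cell j)
    x : Fin q → Fin (suc m) → Fin q
    x j = proj₂ (cell j)
    heads : sum (λ j → x j zero ⊕ i (x₀ j)) ≡ sumAll ⊕ sum i
    heads = trans (∑-distrib-+ (λ j → x j zero) (i ∘ x₀))
                  (cong₂ _⊕_ (sum-injective (coordinate-injective zero)) (sum-∘-injective layer-injective i))
    tails : sum (λ j → sum (x j ∘ suc)) ≡ m · sumAll
    tails = begin
      sum (λ j → sum (x j ∘ suc))             ≡⟨ ∑-comm (λ j k → x j (suc k)) ⟩
      sum {m} (λ k → sum (λ j → x j (suc k))) ≡⟨ sum-cong-≗ (λ k → sum-injective (coordinate-injective (suc k))) ⟩
      sum {m} (λ _ → sumAll)                  ≡⟨ sum-replicate m ⟩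
      m · sumAll                              ∎

  ⇒transversal : ∀ (i : Fin q → Fin q) m → sum i ⊕ (m · sumAll) ≡ zero → HasTransversal (Ccube i m)
  ⇒transversal i m Σi+m·Σ≡0 = (λ j → j , diagonal j) , id , coordinate-injective , symbol-injective
    where
    Σd≡0 : sum (λ j → i j ⊕ (m · j)) ≡ zero
    Σd≡0 = trans (∑-distrib-+ i (m ·_)) (trans (cong (sum i ⊕_) (sum-· m id)) Σi+m·Σ≡0)
    open PermutationDifference (hall (λ j → i j ⊕ (m · j)) Σd≡0)
    diagonal : Fin q → Fin (suc m) → Fin q
    diagonal j zero    = α j
    diagonal j (suc _) = j
    coordinate-injective : ∀ k → Injective _≡_ _≡_ (λ j → diagonal j k)
    coordinate-injective zero    = α-injective
    coordinate-injective (suc _) = id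
    symbol≡β : ∀ j → Ccube i m j (diagonal j) ≡ β j
    symbol≡β j = begin
      Ccube i m j (diagonal j)            ≡⟨ Ccube≡ i m j (diagonal j) ⟩
      (α j ⊕ i j) ⊕ sum {m} (λ _ → j)     ≡⟨ cong ((α j ⊕ i j) ⊕_) (sum-replicate m) ⟩
      (α j ⊕ i j) ⊕ (m · j)               ≡⟨ ⊕-assoc (α j) (i j) (m · j) ⟩
      α j ⊕ (i j ⊕ (m · j))               ≡⟨ β≡α+d j ⟨
      β j                                 ∎
    symbol-injective : Injective _≡_ _≡_ (λ j → Ccube i m j (diagonal j))
    symbol-injective {j} {j′} eq = β-injective (trans (sym (symbol≡β j)) (trans eq (symbol≡β j′)))

  transversal⇔sumQ≡ : ∀ (i : Fin q → Fin q) m {c} → m · sumAll ≡ c → c ⊕ c ≡ zero →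
                      HasTransversal (Ccube i m) ⇔ sumQ i ≡ c
  transversal⇔sumQ≡ i m refl c+c≡0 = mk⇔
    (λ transversal → trans (sumQ≡sum i) (to (transversal⇒ i m transversal)))
    (λ sumQ≡c → ⇒transversal i m (from (trans (sym (sumQ≡sum i)) sumQ≡c)))
    where open Equivalence (+-order-two⇒[+≡0⇔≡] {m · sumAll} c+c≡0 (sum i))

corollary4 : (q : ℕ) .{{_ : NonZero q}} → 2 ≤ q → (m : ℕ) → (i : Fin q → Fin q) →
    (q % 2 ≡ 1 → (HasTransversal (Ccube i m) ⇔ (sumQ i ≡ 0 mod q))) ×
    (q % 2 ≡ 0 → (suc m % 2 ≡ 1 → (HasTransversal (Ccube i m) ⇔ (sumQ i ≡ 0 mod q))) ×
                 (suc m % 2 ≡ 0 → (HasTransversal (Ccube i m) ⇔ (sumQ i ≡ (q / 2) mod q))))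
-- The criterion holds for q = 1 as well.
corollary4 (suc q′) _ m i =
    (λ odd → criterion (trans (cong (m ·_) (sumAll-odd odd)) (·-zero m)) refl)
  , λ even → (λ n-odd  → criterion (proj₁ (m·sumAll-even even) n-odd) refl)
           , (λ n-even → criterion (proj₂ (m·sumAll-even even) n-even) (half-order-two even))
  where
  open Cyclic q′
  criterion : ∀ {c} → m · sumAll ≡ c → c ⊕ c ≡ zero → HasTransversal (Ccube i m) ⇔ sumQ i ≡ c
  criterion = transversal⇔sumQ≡ i m
  m·sumAll-even : q % 2 ≡ 0 → (suc m % 2 ≡ 1 → m · sumAll ≡ zero) × (suc m % 2 ≡ 0 → m · sumAll ≡ half)
  m·sumAll-even even rewrite sumAll-even even = ·-order-two (half-order-two even) m
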